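{- Let $a,b,n$ be positive integers. Then \[\left\lfloor \frac{b+\sqrt[3]{9n+1}}{a}\right\rfloor=\left\lfloor \frac{b+\sqrt[3]{9n+2}}{a}\right\rfloor=\cdots=\left\lfloor \frac{b+\sqrt[3]{9n+6}}{a}\right\rfloor=\left\lfloor \frac{b+\sqrt[3]{9n+7}}{a}\right\rfloor ,\] i.e. $\left\lfloor \frac{b+\sqrt[3]{9n+j}}{a}\right\rfloor$ takes the same value for all $j\in\{1,2,\dots,7\}$.
   Context: $\lfloor y\rfloor$ denotes the greatest integer less than or equal to $y$; $\sqrt[3]{\cdot}$ is the real cube root. -}

module Defs where

open import Data.Nat using (ℕ; suc)
open import Data.Integer using (ℤ; +_; _+_; _-_; _*_; _^_; _≤_; _<_)
open import Data.Product using (_×_)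

-- IsFloorCbrtQuot a b m k  means  k = ⌊ (b + ∛m) / a ⌋  (a > 0, m real cube root).
-- For a > 0 and integer k:
--   k ≤ (b + ∛m)/a      ⇔  a*k - b ≤ ∛m      ⇔  (a*k - b)^3 ≤ m
--   (b + ∛m)/a < k + 1  ⇔  ∛m < a*(k+1) - b  ⇔  m < (a*(k+1) - b)^3
-- since t ↦ t^3 is strictly increasing on all reals (also for negative t).
IsFloorCbrtQuot : ℕ → ℕ → ℕ → ℤ → Set
IsFloorCbrtQuot a b m k =
  ((+ a) * k - + b) ^ 3 ≤ + m × + m < ((+ a) * (k + + 1) - + b) ^ 3

module Submission where

open import Defs
open import Data.Nat using (ℕ; suc; _+_; _*_; _≥_)
open import Data.Integer using (ℤ)
open import Data.Fin using (Fin; toℕ)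
open import Data.Product using (∃)

open import Data.Nat using (zero; _≤_; _<_; _^_; _∸_; _%_; z≤n; s≤s; NonZero)
open import Data.Nat.Properties
open import Data.Nat.DivMod using (%-distribˡ-*; m%n%n≡m%n; [m+kn]%n≡m%n; m≤n⇒m%n≡m; m%n<n)
open import Data.Integer using (+_; -[1+_]; 0ℤ; +≤+; -≤+)
import Data.Integer as ℤ
import Data.Integer.Properties as ℤ
open import Data.Fin.Properties using (toℕ<n)
open import Data.Product using (_×_; _,_)
open import Data.Sum using (_⊎_; inj₁; inj₂; [_,_])
open import Data.Empty using (⊥)
open import Relation.Nullary using (¬_; yes; no; contradiction)
open import Level using (0ℓ)
open import Relation.Unary using (Pred; Decidable)
open import Relation.Binary.PropositionalEquality using (_≡_; refl; sym; trans; cong; subst; module ≡-Reasoning)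

-- Every integer cube is ≡ 0 or ±1 (mod 9), so no cube lies in [9n+2, 9n+7].  If
-- k = ⌊(b + ∛m)/a⌋ and m ≤ m′, then k = ⌊(b + ∛m′)/a⌋ unless the cube (a(k+1) - b)³
-- lies in (m, m′]; hence the value is the same for 9n+1, …, 9n+7.

switch-point : ∀ {p} {P : Pred ℕ p} → Decidable P → P 0 → ∀ N → ¬ P N →
               ∃ λ k → P k × ¬ P (suc k)
switch-point P? P0 zero ¬PN = contradiction P0 ¬PN
switch-point P? P0 (suc N) ¬P1+N with P? N
... | yes PN = N , PN , ¬P1+N
... | no ¬PN = switch-point P? P0 N ¬PN

n≤n³ : ∀ n → n ≤ n ^ 3
n≤n³ zero    = z≤n
n≤n³ (suc n) = m≤m*n (suc n) (suc n ^ 2)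

%-distribˡ-^ : ∀ m n d .{{_ : NonZero d}} → m ^ n % d ≡ (m % d) ^ n % d
%-distribˡ-^ m zero    d = refl
%-distribˡ-^ m (suc n) d = begin
  m * m ^ n % d                         ≡⟨ %-distribˡ-* m (m ^ n) d ⟩
  m % d * (m ^ n % d) % d               ≡⟨ cong (λ x → m % d * x % d) (%-distribˡ-^ m n d) ⟩
  m % d * ((m % d) ^ n % d) % d         ≡⟨ cong (λ x → x * ((m % d) ^ n % d) % d) (m%n%n≡m%n m d) ⟨
  m % d % d * ((m % d) ^ n % d) % d     ≡⟨ %-distribˡ-* (m % d) ((m % d) ^ n) d ⟨
  m % d * (m % d) ^ n % d               ∎
  where open ≡-Reasoning

pos-^ : ∀ x n → (+ x) ℤ.^ n ≡ + (x ^ n)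
pos-^ x zero    = refl
pos-^ x (suc n) = trans (cong ((+ x) ℤ.*_) (pos-^ x n)) (sym (ℤ.pos-* x (x ^ n)))

+[m+n]-+m≡+n : ∀ m n → + (m + n) ℤ.- + m ≡ + n
+[m+n]-+m≡+n m n = begin
  + (m + n) ℤ.- + m   ≡⟨ ℤ.[+m]-[+n]≡m⊖n (m + n) m ⟩
  (m + n) ℤ.⊖ m       ≡⟨ ℤ.⊖-≥ (m≤m+n m n) ⟩
  + (m + n ∸ m)       ≡⟨ cong +_ (m+n∸m≡n m n) ⟩
  + n                 ∎
  where open ≡-Reasoning

cube-mod-9 : ∀ x → x ^ 3 % 9 ≤ 1 ⊎ 8 ≤ x ^ 3 % 9
cube-mod-9 x =
  subst (λ s → s ≤ 1 ⊎ 8 ≤ s) (sym (%-distribˡ-^ x 3 9)) (residue (x % 9) (m%n<n x 9))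
  where
  residue : ∀ r → r < 9 → r ^ 3 % 9 ≤ 1 ⊎ 8 ≤ r ^ 3 % 9
  residue 0 _ = inj₁ z≤n
  residue 1 _ = inj₁ ≤-refl
  residue 2 _ = inj₂ ≤-refl
  residue 3 _ = inj₁ z≤n
  residue 4 _ = inj₁ ≤-refl
  residue 5 _ = inj₂ ≤-refl
  residue 6 _ = inj₁ z≤n
  residue 7 _ = inj₁ ≤-refl
  residue 8 _ = inj₂ ≤-refl
  residue (suc (suc (suc (suc (suc (suc (suc (suc (suc r))))))))) r<9 = contradiction r<9 (m+n≮m 9 r)

[9q+r]%9≡r : ∀ q {r} → r ≤ 8 → (9 * q + r) % 9 ≡ r
[9q+r]%9≡r q {r} r≤8 = begin
  (9 * q + r) % 9   ≡⟨ cong (_% 9) (+-comm (9 * q) r) ⟩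
  (r + 9 * q) % 9   ≡⟨ cong (λ x → (r + x) % 9) (*-comm 9 q) ⟩
  (r + q * 9) % 9   ≡⟨ [m+kn]%n≡m%n r q 9 ⟩
  r % 9             ≡⟨ m≤n⇒m%n≡m r≤8 ⟩
  r                 ∎
  where open ≡-Reasoning

¬9q+1<x³≤9q+7 : ∀ q x → 9 * q + 1 < x ^ 3 → x ^ 3 ≤ 9 * q + 7 → ⊥
¬9q+1<x³≤9q+7 q x lo hi =
  [ <⇒≱ 1<r , <⇒≱ (s≤s r≤7) ] (subst (λ s → s ≤ 1 ⊎ 8 ≤ s) x³%9≡r (cube-mod-9 x))
  where
  r : ℕ
  r = x ^ 3 ∸ 9 * q
  x³≡9q+r : x ^ 3 ≡ 9 * q + r
  x³≡9q+r = sym (m+[n∸m]≡n (≤-trans (m≤m+n (9 * q) 1) (<⇒≤ lo)))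
  1<r : 1 < r
  1<r = +-cancelˡ-< (9 * q) 1 r (subst (9 * q + 1 <_) x³≡9q+r lo)
  r≤7 : r ≤ 7
  r≤7 = +-cancelˡ-≤ (9 * q) r 7 (subst (_≤ 9 * q + 7) x³≡9q+r hi)
  x³%9≡r : x ^ 3 % 9 ≡ r
  x³%9≡r = trans (cong (_% 9) x³≡9q+r) ([9q+r]%9≡r q (≤-trans r≤7 (n≤1+n 7)))

NoCubeIn : ℕ → ℕ → Set
NoCubeIn m m′ = ∀ c → + m ℤ.< c ℤ.^ 3 → c ℤ.^ 3 ℤ.≤ + m′ → ⊥

noCubeIn-shrinkʳ : ∀ {m m′ m″} → m′ ≤ m″ → NoCubeIn m m″ → NoCubeIn m m′
noCubeIn-shrinkʳ m′≤m″ none c lo hi = none c lo (ℤ.≤-trans hi (+≤+ m′≤m″))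

noCubeIn-9q+1-9q+7 : ∀ q → NoCubeIn (9 * q + 1) (9 * q + 7)
noCubeIn-9q+1-9q+7 q (+ x) lo hi = ¬9q+1<x³≤9q+7 q x
  (ℤ.drop‿+<+ (subst (+ (9 * q + 1) ℤ.<_) (pos-^ x 3) lo))
  (ℤ.drop‿+≤+ (subst (ℤ._≤ + (9 * q + 7)) (pos-^ x 3) hi))
noCubeIn-9q+1-9q+7 q -[1+ x ] () _

isFloorCbrtQuot-stable : ∀ a b {m m′ k} → m ≤ m′ → NoCubeIn m m′ →
                         IsFloorCbrtQuot a b m k → IsFloorCbrtQuot a b m′ k
isFloorCbrtQuot-stable a b {k = k} m≤m′ none (lower , upper) =
  ℤ.≤-trans lower (+≤+ m≤m′) , ℤ.≰⇒> (none ((+ a) ℤ.* (k ℤ.+ + 1) ℤ.- + b) upper)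

[0-b]³≤m : ∀ b m → (0ℤ ℤ.- + b) ℤ.^ 3 ℤ.≤ + m
[0-b]³≤m zero    m = +≤+ z≤n
[0-b]³≤m (suc b) m = -≤+

isFloorCbrtQuot-exists : ∀ {a} → 1 ≤ a → ∀ b m → ∃ (IsFloorCbrtQuot a b m)
isFloorCbrtQuot-exists {suc a′} _ b m = floor (switch-point Below? below-0 N ¬below-N)
  where
  a N : ℕ
  a = suc a′
  N = b + suc m

  Below : Pred ℕ 0ℓ
  Below k = ((+ a) ℤ.* (+ k) ℤ.- + b) ℤ.^ 3 ℤ.≤ + m

  Below? : Decidable Below
  Below? k = _ ℤ.≤? + m

  below-0 : Below 0
  below-0 = subst (λ i → (i ℤ.- + b) ℤ.^ 3 ℤ.≤ + m) (sym (ℤ.*-zeroʳ (+ a))) ([0-b]³≤m b m)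

  aN-b≡t : (+ a) ℤ.* (+ N) ℤ.- + b ≡ + (suc m + a′ * N)
  aN-b≡t = begin
    (+ a) ℤ.* (+ N) ℤ.- + b        ≡⟨ cong (ℤ._- + b) (ℤ.pos-* a N) ⟨
    + (N + a′ * N) ℤ.- + b         ≡⟨ cong (λ x → + x ℤ.- + b) (+-assoc b (suc m) (a′ * N)) ⟩
    + (b + (suc m + a′ * N)) ℤ.- + b ≡⟨ +[m+n]-+m≡+n b (suc m + a′ * N) ⟩
    + (suc m + a′ * N)             ∎
    where open ≡-Reasoning

  ¬below-N : ¬ Below N
  ¬below-N below-N = <⇒≱ m<t³ (ℤ.drop‿+≤+ (subst (ℤ._≤ + m) t³≡ below-N))
    where
    t = suc m + a′ * N
    m<t³ : m < t ^ 3
    m<t³ = ≤-trans (m≤m+n (suc m) (a′ * N)) (n≤n³ t)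
    t³≡ : ((+ a) ℤ.* (+ N) ℤ.- + b) ℤ.^ 3 ≡ + (t ^ 3)
    t³≡ = trans (cong (ℤ._^ 3) aN-b≡t) (pos-^ t 3)

  floor : ∃ (λ k → Below k × ¬ Below (suc k)) → ∃ (IsFloorCbrtQuot a b m)
  floor (k , lower , ¬upper) = + k , lower , ℤ.≰⇒> (subst (λ i → ¬ Below i) (+-comm 1 k) ¬upper)

corollary8 : (a b n : ℕ) → a ≥ 1 → b ≥ 1 → n ≥ 1 →
    ∃ λ (k : ℤ) → (j : Fin 7) → IsFloorCbrtQuot a b (9 * n + suc (toℕ j)) k
corollary8 a b n a≥1 _ _ =
  let k , floor = isFloorCbrtQuot-exists a≥1 b (9 * n + 1) in
  k , λ j → isFloorCbrtQuot-stable a b (+-monoʳ-≤ (9 * n) (s≤s z≤n))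
              (noCubeIn-shrinkʳ (+-monoʳ-≤ (9 * n) (toℕ<n j)) (noCubeIn-9q+1-9q+7 n))
              floor
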